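{- Let $\alpha=(a_1,\dots,a_w)$ be a sequence of reals with QN-list $\mathbb{L}_\alpha$ having $m$ horizontal lists, and let $1\le t\le m$ (with $Left(\mathbb{L}_\alpha^{m+1})$ understood to be empty). The list formed by the items of $Left(\mathbb{L}_\alpha^{t+1})$ (in their order in $\mathbb{L}_\alpha^{t+1}$) followed by the items of $Right(\mathbb{L}_\alpha^t)$ (in their order in $\mathbb{L}_\alpha^t$) is monotonically decreasing in value from left to right.
   Context: Items are identified with their positions. An increasing subsequence is a subsequence $a_{i_1},\dots,a_{i_k}$, $i_1<\dots<i_k$, with $a_{i_1}\le\dots\le a_{i_k}$; the rising length $RL_\alpha(a_i)$ is the maximum length of an increasing subsequence ending with $a_i$. The up neighbor $un_\alpha(a_i)$ is the nearest item before $a_i$ with rising length $RL_\alpha(a_i)-1$; $un_\alpha^0(a)=a$, $un_\alpha^k(a)=un_\alpha(un_\alpha^{k-1}(a))$. The horizontal list $\mathbb{L}_\alpha^t$ is the list of items of rising length $t$ in increasing order of position. For the deletion of the first item $a_1$: $Left(\mathbb{L}_\alpha^t)$ is the sublist of $\mathbb{L}_\alpha^t$ consisting of the items $a$ with $un_\alpha^{t-1}(a)=a_1$ (so $Left(\mathbb{L}_\alpha^1)=(a_1)$), and $Right(\mathbb{L}_\alpha^t)$ is the sublist of the remaining items of $\mathbb{L}_\alpha^t$. -}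

module Defs where

open import Level using (Level; _⊔_)
open import Data.Nat as ℕ using (ℕ; zero; suc; _∸_)
open import Data.Fin as F using (Fin)
open import Data.List using (List; []; _∷_; _∷ʳ_; length)
open import Data.List.Membership.Propositional using (_∈_)
open import Data.List.Relation.Unary.Linked using (Linked)
open import Data.Product using (Σ; ∃; _×_)
open import Relation.Nullary using (¬_)
open import Relation.Binary.Bundles using (TotalOrder)

-- Everything is parameterised by the order on the values (the reals in the
-- paper; any total order here) and by the sequence α = (a_1,…,a_w), w = suc n.
-- Items are identified with their positions, i.e. elements of Fin (suc n);
-- position F.zero is the first item a_1.
module Seq {c ℓ₁ ℓ₂ : Level} (O : TotalOrder c ℓ₁ ℓ₂)
           (n : ℕ) (a : Fin (suc n) → TotalOrder.Carrier O) where
  open TotalOrder O renaming (_≤_ to _≼_)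

  Pos : Set
  Pos = Fin (suc n)

  _≻_ : TotalOrder.Carrier O → TotalOrder.Carrier O → Set ℓ₂
  x ≻ y = ¬ (x ≼ y)

  IsIncreasingSubseq : List Pos → Set ℓ₂
  IsIncreasingSubseq = Linked (λ i j → (i F.< j) × (a i ≼ a j))

  IsRL : Pos → ℕ → Set ℓ₂
  IsRL i k =
    (Σ (List Pos) λ xs → IsIncreasingSubseq (xs ∷ʳ i) × length (xs ∷ʳ i) ≡ k)
    × (∀ (xs : List Pos) → IsIncreasingSubseq (xs ∷ʳ i) → length (xs ∷ʳ i) ℕ.≤ k)
    where open import Relation.Binary.PropositionalEquality using (_≡_)

  IsUN : Pos → Pos → Set ℓ₂
  IsUN i j = Σ ℕ λ k →
    IsRL i (suc k) × IsRL j k × (j F.< i)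
    × (∀ (j' : Pos) → j F.< j' → j' F.< i → ¬ IsRL j' k)

  data IsUNPow : ℕ → Pos → Pos → Set ℓ₂ where
    un-zero : ∀ {i} → IsUNPow zero i i
    un-suc  : ∀ {k i j l} → IsUNPow k i j → IsUN j l → IsUNPow (suc k) i l

  InL : ℕ → Pos → Set ℓ₂
  InL t i = IsRL i t

  InLeft : ℕ → Pos → Set ℓ₂
  InLeft t i = InL t i × IsUNPow (t ∸ 1) i F.zero

  InRight : ℕ → Pos → Set ℓ₂
  InRight t i = InL t i × ¬ IsUNPow (t ∸ 1) i F.zero

  Enumerates : (Pos → Set ℓ₂) → List Pos → Set ℓ₂
  Enumerates P xs = Linked F._<_ xs × (∀ i → (i ∈ xs → P i) × (P i → i ∈ xs))

  NumHorizontalLists : ℕ → Set ℓ₂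
  NumHorizontalLists m = (Σ Pos λ i → IsRL i m) × (∀ i k → IsRL i k → k ℕ.≤ m)

  DecreasingInValue : List Pos → Set ℓ₂
  DecreasingInValue = Linked (λ i j → a i ≻ a j)

-- Up-neighbour chains on one level never cross: if y < u lie on level s + 1 and un^s(u) = a₁,
-- then un(y) ≤ un(u), since un(y) cannot lie strictly between un(u) and u; so by induction
-- un^s(y) = a₁ as well. Hence Left(𝕃^t) is an initial segment of 𝕃^t, and each x in Left(𝕃^(t+1))
-- precedes each y in Right(𝕃^t): y < x would put y before un(x) ∈ Left(𝕃^t) or strictly between
-- un(x) and x. Items of one level decrease in value, and x < y with a_x ≤ a_y would give y a
-- rising length greater than t + 1.
module Submission where

open import Defs
open import Level using (Level)
open import Data.Nat using (ℕ; suc; _≤_)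
open import Data.Fin using (Fin)
open import Data.List using (List; _++_)
open import Relation.Binary.Bundles using (TotalOrder)

open import Function using (_∘_)
open import Data.Nat as ℕ using (zero)
open import Data.Nat.Properties using (≤-antisym; ≤-reflexive; ≤-pred; <⇒≤; 1+n≰n; suc-injective; 0≢1+n; +-comm)
open import Data.Fin as F using ()
open import Data.Fin.Properties using (<-cmp; <-trans)
open import Data.Fin.Induction using (>-wellFounded)
open import Data.List using ([]; _∷_; _∷ʳ_; length; initLast; _∷ʳ′_)
open import Data.List.Properties using (length-++)
open import Data.List.Membership.Propositional using (_∈_)
open import Data.List.Relation.Unary.All as All using (All; []; _∷_)
open import Data.List.Relation.Unary.Any using (here; there)
open import Data.List.Relation.Unary.Linked using (Linked; []; [-]; _∷_)
open import Data.Empty using (⊥-elim)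
open import Data.Product using (Σ; _×_; _,_; proj₁)
open import Induction.WellFounded using (Acc; acc)
open import Relation.Nullary using (¬_)
open import Relation.Nullary.Negation using (¬¬-map)
open import Relation.Unary using (Pred)
open import Relation.Binary.Core using (Rel)
open import Relation.Binary.Definitions using (tri<; tri≈; tri>)
open import Relation.Binary.PropositionalEquality using (_≡_; refl; sym; trans; subst; cong)

module _ {a r : Level} {A : Set a} {R : Rel A r} where

  Linked-∷ʳ⁺ : ∀ xs {x y} → Linked R (xs ∷ʳ x) → R x y → Linked R (xs ∷ʳ x ∷ʳ y)
  Linked-∷ʳ⁺ []           _            Rxy = Rxy ∷ [-]
  Linked-∷ʳ⁺ (_ ∷ [])     (Rzw ∷ rest) Rxy = Rzw ∷ Linked-∷ʳ⁺ [] rest Rxy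
  Linked-∷ʳ⁺ (_ ∷ w ∷ ws) (Rzw ∷ rest) Rxy = Rzw ∷ Linked-∷ʳ⁺ (w ∷ ws) rest Rxy

  Linked-∷ʳ⁻ : ∀ xs {x y} → Linked R (xs ∷ʳ x ∷ʳ y) → Linked R (xs ∷ʳ x) × R x y
  Linked-∷ʳ⁻ [] (Rxy ∷ [-]) = [-] , Rxy
  Linked-∷ʳ⁻ (_ ∷ []) (Rzw ∷ rest) with Linked-∷ʳ⁻ [] rest
  ... | l , Rxy = Rzw ∷ l , Rxy
  Linked-∷ʳ⁻ (_ ∷ w ∷ ws) (Rzw ∷ rest) with Linked-∷ʳ⁻ (w ∷ ws) rest
  ... | l , Rxy = Rzw ∷ l , Rxy

  Linked-++⁺ : ∀ {xs ys} → Linked R xs → Linked R ys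
             → (∀ {x y} → x ∈ xs → y ∈ ys → R x y) → Linked R (xs ++ ys)
  Linked-++⁺ []                  Rys _     = Rys
  Linked-++⁺ {ys = []}    [-]    _   _     = [-]
  Linked-++⁺ {ys = _ ∷ _} [-]    Rys cross = cross (here refl) (here refl) ∷ Rys
  Linked-++⁺ (Rxy ∷ Rxs)         Rys cross = Rxy ∷ Linked-++⁺ Rxs Rys (cross ∘ there)

length-∷ʳ : ∀ {a} {A : Set a} (xs : List A) x → length (xs ∷ʳ x) ≡ suc (length xs)
length-∷ʳ xs x = trans (length-++ xs) (+-comm (length xs) 1)

module _ {n : ℕ} {ℓ : Level} (P : Pred (Fin n) ℓ) where

  NearestBelow : Fin n → Set ℓ
  NearestBelow y = Σ (Fin n) λ i → P i × i F.< y × (∀ i' → i F.< i' → i' F.< y → ¬ P i')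

  -- Constructive only up to ¬¬: P need not be decidable.
  nearest-below : ∀ {j y : Fin n} → P j → j F.< y → ¬ ¬ NearestBelow y
  nearest-below {j} = go (>-wellFounded j)
    where
    go : ∀ {j y : Fin n} → Acc F._>_ j → P j → j F.< y → ¬ ¬ NearestBelow y
    go {j} (acc further) Pj j<y ¬nearest =
      ¬nearest (j , Pj , j<y , λ i' j<i' i'<y Pi' → go (further j<i') Pi' i'<y ¬nearest)

module QNList {c ℓ₁ ℓ₂ : Level} (O : TotalOrder c ℓ₁ ℓ₂) (n : ℕ)
              (a : Fin (suc n) → TotalOrder.Carrier O) where
  open Seq O n a
  open TotalOrder O using () renaming (_≤_ to _≼_)

  IsRL-unique : ∀ {i k k'} → IsRL i k → IsRL i k' → k ≡ k'
  IsRL-unique ((xs , inc , len) , max) ((xs' , inc' , len') , max') =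
    ≤-antisym (subst (_≤ _) len (max' xs inc)) (subst (_≤ _) len' (max xs' inc'))

  IsRL-< : ∀ {i j k k'} → IsRL i k → IsRL j k' → i F.< j → a i ≼ a j → k ℕ.< k'
  IsRL-< {i} {j} ((xs , inc , len) , _) (_ , max) i<j ai≼aj =
    subst (_≤ _) (trans (length-∷ʳ (xs ∷ʳ i) j) (cong suc len))
          (max (xs ∷ʳ i) (Linked-∷ʳ⁺ xs inc (i<j , ai≼aj)))

  sameLevel⇒≻ : ∀ {i j k} → IsRL i k → IsRL j k → i F.< j → a i ≻ a j
  sameLevel⇒≻ ri rj i<j ai≼aj = 1+n≰n (IsRL-< ri rj i<j ai≼aj)

  sameLevel⇒DecreasingInValue : ∀ {k xs} → Linked F._<_ xs → All (λ i → IsRL i k) xs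
                              → DecreasingInValue xs
  sameLevel⇒DecreasingInValue []          _                = []
  sameLevel⇒DecreasingInValue [-]         _                = [-]
  sameLevel⇒DecreasingInValue (i<j ∷ rest) (ri ∷ rj ∷ rs) =
    sameLevel⇒≻ ri rj i<j ∷ sameLevel⇒DecreasingInValue rest (rj ∷ rs)

  IsRL-penultimate : ∀ {y s} → IsRL y (suc (suc s)) → Σ Pos λ p → p F.< y × IsRL p (suc s)
  IsRL-penultimate {y} {s} ((xs , inc , len) , max) with initLast xs
  ... | []      = ⊥-elim (0≢1+n (suc-injective len))
  ... | ys ∷ʳ′ p with Linked-∷ʳ⁻ ys inc
  ...   | inc-p , (p<y , ap≼ay) = p , p<y , (ys , inc-p , len-p) , max-p
    where
    len-p : length (ys ∷ʳ p) ≡ suc s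
    len-p = suc-injective (trans (sym (length-∷ʳ (ys ∷ʳ p) y)) len)
    max-p : ∀ zs → IsIncreasingSubseq (zs ∷ʳ p) → length (zs ∷ʳ p) ≤ suc s
    max-p zs inc-zs = ≤-pred (subst (_≤ _) (length-∷ʳ (zs ∷ʳ p) y)
                                   (max (zs ∷ʳ p) (Linked-∷ʳ⁺ zs inc-zs (p<y , ap≼ay))))

  IsUN-level : ∀ {i j k} → IsUN i j → IsRL i (suc k) → IsRL j k
  IsUN-level (_ , ri , rj , _) ri' = subst (IsRL _) (suc-injective (IsRL-unique ri ri')) rj

  IsUN-< : ∀ {i j} → IsUN i j → j F.< i
  IsUN-< (_ , _ , _ , j<i , _) = j<i

  IsUN-nearest : ∀ {i j k} → IsUN i j → IsRL j k → ∀ j' → j F.< j' → j' F.< i → ¬ IsRL j' k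
  IsUN-nearest (_ , _ , rj , _ , nearest) rj' j' j<j' j'<i =
    nearest j' j<j' j'<i ∘ subst (IsRL j') (IsRL-unique rj' rj)

  IsUN-exists : ∀ {y s} → IsRL y (suc (suc s)) → ¬ ¬ Σ Pos (IsUN y)
  IsUN-exists {y} {s} ry with IsRL-penultimate ry
  ... | p , p<y , rp = ¬¬-map nearest⇒IsUN (nearest-below (λ j → IsRL j (suc s)) rp p<y)
    where
    nearest⇒IsUN : NearestBelow (λ j → IsRL j (suc s)) y → Σ Pos (IsUN y)
    nearest⇒IsUN (j , rj , j<y , nearest) = j , suc s , ry , rj , j<y , nearest

  IsUNPow-first : ∀ {k i l} → IsUNPow (suc k) i l → Σ Pos λ j → IsUN i j × IsUNPow k j l
  IsUNPow-first (un-suc un-zero ij) = _ , ij , un-zero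
  IsUNPow-first (un-suc p@(un-suc _ _) u) with IsUNPow-first p
  ... | j , ij , rest = j , ij , un-suc rest u

  IsUNPow-prepend : ∀ {k i j l} → IsUN i j → IsUNPow k j l → IsUNPow (suc k) i l
  IsUNPow-prepend ij un-zero      = un-suc un-zero ij
  IsUNPow-prepend ij (un-suc p u) = un-suc (IsUNPow-prepend ij p) u

  Left-downward-closed : ∀ s {y u} → y F.< u → InLeft (suc s) u → ¬ InRight (suc s) y
  Right-not-below-un-of-Left : ∀ s {x u y} → IsUN x u → InLeft (suc s) u → y F.< x
                             → ¬ InRight (suc s) y

  Left-downward-closed zero    () (_ , un-zero)
  Left-downward-closed (suc s) y<u (ru , u↝a₁) (ry , ¬y↝a₁) with IsUNPow-first u↝a₁
  ... | u' , uu' , u'↝a₁ = IsUN-exists ry λ (y' , yy') →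
    Right-not-below-un-of-Left s uu' (IsUN-level uu' ru , u'↝a₁) (<-trans (IsUN-< yy') y<u)
      (IsUN-level yy' ry , ¬y↝a₁ ∘ IsUNPow-prepend yy')

  Right-not-below-un-of-Left s {u = u} {y} xu (ru , u↝a₁) y<x (ry , ¬y↝a₁) with <-cmp y u
  ... | tri< y<u _ _ = Left-downward-closed s y<u (ru , u↝a₁) (ry , ¬y↝a₁)
  ... | tri≈ _ refl _ = ¬y↝a₁ u↝a₁
  ... | tri> _ _ u<y = IsUN-nearest xu ru y u<y y<x ry

  Left-suc-before-Right : ∀ s {x y} → InLeft (suc (suc s)) x → InRight (suc s) y → x F.< y
  Left-suc-before-Right s {x} {y} (rx , x↝a₁) (ry , ¬y↝a₁) with <-cmp x y
  ... | tri< x<y _ _ = x<y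
  ... | tri≈ _ refl _ = ⊥-elim (1+n≰n (≤-reflexive (IsRL-unique rx ry)))
  ... | tri> _ _ y<x with IsUNPow-first x↝a₁
  ...   | u , xu , u↝a₁ =
    ⊥-elim (Right-not-below-un-of-Left s xu (IsUN-level xu rx , u↝a₁) y<x (ry , ¬y↝a₁))

theorem5 : ∀ {c ℓ₁ ℓ₂ : Level} (O : TotalOrder c ℓ₁ ℓ₂) (n : ℕ)
    (a : Fin (suc n) → TotalOrder.Carrier O) (m t : ℕ)
    → Seq.NumHorizontalLists O n a m
    → 1 ≤ t → t ≤ m
    → (ls rs : List (Fin (suc n)))
    → Seq.Enumerates O n a (Seq.InLeft O n a (suc t)) ls
    → Seq.Enumerates O n a (Seq.InRight O n a t) rs
    → Seq.DecreasingInValue O n a (ls ++ rs)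
theorem5 O n a m (suc s) _ _ _ ls rs (ls-sorted , ls-spec) (rs-sorted , rs-spec) =
  Linked-++⁺ (sameLevel⇒DecreasingInValue ls-sorted (All.tabulate (proj₁ ∘ inLeft)))
             (sameLevel⇒DecreasingInValue rs-sorted (All.tabulate (proj₁ ∘ inRight)))
             left≻right
  where
  open Seq O n a using (InLeft; InRight; _≻_)
  open QNList O n a
  inLeft : ∀ {i} → i ∈ ls → InLeft (suc (suc s)) i
  inLeft = proj₁ (ls-spec _)
  inRight : ∀ {i} → i ∈ rs → InRight (suc s) i
  inRight = proj₁ (rs-spec _)
  left≻right : ∀ {x y} → x ∈ ls → y ∈ rs → a x ≻ a y
  left≻right x∈ y∈ ax≼ay =
    1+n≰n (<⇒≤ (IsRL-< (proj₁ (inLeft x∈)) (proj₁ (inRight y∈))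
                       (Left-suc-before-Right s (inLeft x∈) (inRight y∈)) ax≼ay))
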